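{- Let $J$ be an abelian variety over $\mathbb{Q}_2$, $m \ge 0$ an integer, and $P_1, P_2 \in J(\mathbb{Q}_2)$ with $P_1 \notin 2^{m+1}J(\mathbb{Q}_2)$ and $P_1 - P_2 \in 2^{m+1}J(\mathbb{Q}_2)$. Then $\nu(P_1) = \nu(P_2)$ and $q(P_1) = q(P_2)$.
   Context: $\pi \colon J(\mathbb{Q}_2) \to J(\mathbb{Q}_2)/2J(\mathbb{Q}_2)$ is the quotient map; $q(P) = \{\pi(Q) : Q \in J(\mathbb{Q}_2),\ \exists n \ge 0 \colon 2^n Q = P\}$ and $\nu(P) = \sup\{n \ge 0 : P \in 2^n J(\mathbb{Q}_2)\}$. -}

module Defs where

open import Level using (Level; _⊔_)
open import Data.Nat using (ℕ; zero; suc; _^_) renaming (_≤_ to _≤ℕ_)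
open import Data.Product using (Σ; _×_; ∃; ∃-syntax)
open import Function.Bundles using (_⇔_)
open import Algebra.Bundles using (AbelianGroup)

data ℕ∞ : Set where
  fin : ℕ → ℕ∞
  ∞   : ℕ∞

data _≤∞_ : ℕ∞ → ℕ∞ → Set where
  fin≤fin : ∀ {m n} → m ≤ℕ n → fin m ≤∞ fin n
  _≤∞∞    : ∀ x → x ≤∞ ∞

IsSup : ∀ {ℓ} → (ℕ → Set ℓ) → ℕ∞ → Set ℓ
IsSup S v = (∀ n → S n → fin n ≤∞ v)
          × (∀ w → (∀ n → S n → fin n ≤∞ w) → v ≤∞ w)

module AbGroupNotions {c ℓ} (A : AbelianGroup c ℓ) where
  open AbelianGroup A

  _·_ : ℕ → Carrier → Carrier
  zero  · x = ε
  suc n · x = x ∙ (n · x)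

  _∈_·A : Carrier → ℕ → Set (c ⊔ ℓ)
  P ∈ k ·A = ∃[ Q ] ((k · Q) ≈ P)

  _∈2^_A : Carrier → ℕ → Set (c ⊔ ℓ)
  P ∈2^ n A = P ∈ (2 ^ n) ·A

  ν≡ : Carrier → ℕ∞ → Set (c ⊔ ℓ)
  ν≡ P v = IsSup (λ n → P ∈2^ n A) v

  -- the equivalence relation defining A/2A: π(x) = π(y)
  _≡mod2_ : Carrier → Carrier → Set (c ⊔ ℓ)
  x ≡mod2 y = (x - y) ∈ 2 ·A

  -- π(x) ∈ q(P)  where q(P) = { π(Q) : ∃ n ≥ 0, 2^n Q = P } ⊆ A/2A
  _∈q_ : Carrier → Carrier → Set (c ⊔ ℓ)
  x ∈q P = ∃[ Q ] ∃[ n ] (((2 ^ n) · Q) ≈ P × x ≡mod2 Q)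

{-# OPTIONS --safe #-}
-- If P − P′ ∈ 2ᵏA but P ∉ 2ᵏA, then P and P′ are divisible by exactly the same powers
-- 2ⁿ (for n ≤ k the difference is absorbed, for n > k neither point is divisible), and
-- every 2ⁿ-th root Q of P has n < k, so Q − 2ᵏ⁻ⁿR is a 2ⁿ-th root of P′ congruent to Q
-- modulo 2A, where 2ᵏR = P − P′.
module Submission where

open import Defs
open import Data.Empty using (⊥-elim)
open import Data.Nat using (ℕ; suc; _+_; _*_; _∸_; _^_; _≤_; _≤?_; _<?_)
open import Data.Nat.Properties
  using (*-comm; ^-distribˡ-+-*; m∸n+n≡m; <⇒≤; ≰⇒>; ≮⇒≥)
open import Data.Nat.Divisibility using (_∣_; divides)
open import Data.Product using (_×_; _,_; ∃-syntax)
open import Relation.Nullary using (¬_; yes; no)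
open import Function.Bundles using (_⇔_; mk⇔; Equivalence)
open import Function.Properties.Equivalence using () renaming (sym to ⇔-sym)
open import Algebra.Bundles using (AbelianGroup)
open import Relation.Binary.PropositionalEquality using (_≡_)
import Relation.Binary.PropositionalEquality as ≡

IsSup-⇔ : ∀ {a} {S T : ℕ → Set a} → (∀ n → S n ⇔ T n) → ∀ v → IsSup S v ⇔ IsSup T v
IsSup-⇔ S⇔T v = mk⇔ (transport S⇔T) (transport (λ n → ⇔-sym (S⇔T n)))
  where
  transport : ∀ {S T : ℕ → Set _} → (∀ n → S n ⇔ T n) → IsSup S v → IsSup T v
  transport S⇔T (upper , least) =
      (λ n t → upper n (Equivalence.from (S⇔T n) t))
    , (λ w w-upper → least w (λ n s → w-upper n (Equivalence.to (S⇔T n) s)))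

^-monoʳ-∣ : ∀ b {m n} → m ≤ n → b ^ m ∣ b ^ n
^-monoʳ-∣ b {m} {n} m≤n = divides (b ^ (n ∸ m)) (begin
  b ^ n                 ≡⟨ ≡.cong (b ^_) (m∸n+n≡m m≤n) ⟨
  b ^ (n ∸ m + m)       ≡⟨ ^-distribˡ-+-* b (n ∸ m) m ⟩
  b ^ (n ∸ m) * b ^ m   ∎)
  where open ≡.≡-Reasoning

module Divisibility {c ℓ} (A : AbelianGroup c ℓ) where
  open AbelianGroup A
  open AbGroupNotions A
  open import Algebra.Properties.AbelianGroup A using (ε⁻¹≈ε; ⁻¹-∙-comm; ⁻¹-anti-homo‿-; xyx⁻¹≈y; //-cong₂)
  open import Algebra.Properties.CommutativeMonoid.Mult commutativeMonoid
    using (×-assocˡ; ×-distrib-+) renaming (_×_ to _×′_)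
  open import Relation.Binary.Reasoning.Setoid setoid

  ·≡× : ∀ n x → n · x ≡ n ×′ x
  ·≡× 0       x = ≡.refl
  ·≡× (suc n) x = ≡.cong (x ∙_) (·≡× n x)

  ·-assocˡ : ∀ m n x → m · (n · x) ≈ (m * n) · x
  ·-assocˡ m n x rewrite ·≡× n x | ·≡× m (n ×′ x) | ·≡× (m * n) x = ×-assocˡ x m n

  ·-distrib-∙ : ∀ n x y → n · (x ∙ y) ≈ n · x ∙ n · y
  ·-distrib-∙ n x y rewrite ·≡× n (x ∙ y) | ·≡× n x | ·≡× n y = ×-distrib-+ x y n

  ·-homo-⁻¹ : ∀ n x → n · (x ⁻¹) ≈ (n · x) ⁻¹
  ·-homo-⁻¹ 0       x = sym ε⁻¹≈ε
  ·-homo-⁻¹ (suc n) x = begin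
    x ⁻¹ ∙ n · (x ⁻¹)   ≈⟨ ∙-congˡ (·-homo-⁻¹ n x) ⟩
    x ⁻¹ ∙ (n · x) ⁻¹   ≈⟨ ⁻¹-∙-comm x (n · x) ⟩
    (x ∙ n · x) ⁻¹      ∎

  ·-distrib-- : ∀ n x y → n · (x - y) ≈ n · x - n · y
  ·-distrib-- n x y = trans (·-distrib-∙ n x (y ⁻¹)) (∙-congˡ (·-homo-⁻¹ n y))

  x-[x-y]≈y : ∀ x y → x - (x - y) ≈ y
  x-[x-y]≈y x y = begin
    x ∙ (x - y) ⁻¹    ≈⟨ ∙-congˡ (⁻¹-anti-homo‿- x y) ⟩
    x ∙ (y ∙ x ⁻¹)    ≈⟨ assoc x y (x ⁻¹) ⟨
    x ∙ y ∙ x ⁻¹      ≈⟨ xyx⁻¹≈y x y ⟩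
    y                 ∎

  [x-y]∙[y-z]≈x-z : ∀ x y z → (x - y) ∙ (y - z) ≈ x - z
  [x-y]∙[y-z]≈x-z x y z = begin
    (x ∙ y ⁻¹) ∙ (y ∙ z ⁻¹)   ≈⟨ assoc x (y ⁻¹) (y ∙ z ⁻¹) ⟩
    x ∙ (y ⁻¹ ∙ (y ∙ z ⁻¹))   ≈⟨ ∙-congˡ (assoc (y ⁻¹) y (z ⁻¹)) ⟨
    x ∙ (y ⁻¹ ∙ y ∙ z ⁻¹)     ≈⟨ ∙-congˡ (∙-congʳ (inverseˡ y)) ⟩
    x ∙ (ε ∙ z ⁻¹)            ≈⟨ ∙-congˡ (identityˡ (z ⁻¹)) ⟩
    x ∙ z ⁻¹                  ∎

  module _ {k : ℕ} where

    ∈·A-resp-≈ : ∀ {x y} → x ≈ y → x ∈ k ·A → y ∈ k ·A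
    ∈·A-resp-≈ x≈y (Q , kQ≈x) = Q , trans kQ≈x x≈y

    ∈·A-∙ : ∀ {x y} → x ∈ k ·A → y ∈ k ·A → (x ∙ y) ∈ k ·A
    ∈·A-∙ (Q , kQ≈x) (R , kR≈y) = Q ∙ R , trans (·-distrib-∙ k Q R) (∙-cong kQ≈x kR≈y)

    ∈·A-⁻¹ : ∀ {x} → x ∈ k ·A → (x ⁻¹) ∈ k ·A
    ∈·A-⁻¹ (Q , kQ≈x) = Q ⁻¹ , trans (·-homo-⁻¹ k Q) (⁻¹-cong kQ≈x)

    ∈·A-sym : ∀ {x y} → (x - y) ∈ k ·A → (y - x) ∈ k ·A
    ∈·A-sym {x} {y} x-y∈ = ∈·A-resp-≈ (⁻¹-anti-homo‿- x y) (∈·A-⁻¹ x-y∈)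

    ∈·A-trans : ∀ {x y z} → (x - y) ∈ k ·A → (y - z) ∈ k ·A → (x - z) ∈ k ·A
    ∈·A-trans {x} {y} {z} x-y∈ y-z∈ = ∈·A-resp-≈ ([x-y]∙[y-z]≈x-z x y z) (∈·A-∙ x-y∈ y-z∈)

    ∈·A-transfer : ∀ {x y} → (x - y) ∈ k ·A → x ∈ k ·A → y ∈ k ·A
    ∈·A-transfer {x} {y} x-y∈ x∈ = ∈·A-resp-≈ (x-[x-y]≈y x y) (∈·A-∙ x∈ (∈·A-⁻¹ x-y∈))

  ∈·A-∣ : ∀ {d k x} → d ∣ k → x ∈ k ·A → x ∈ d ·A
  ∈·A-∣ {d} {x = x} (divides q ≡.refl) (Q , kQ≈x) = q · Q , (begin
    d · (q · Q)     ≈⟨ ·-assocˡ d q Q ⟩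
    (d * q) · Q     ≡⟨ ≡.cong (_· Q) (*-comm d q) ⟩
    (q * d) · Q     ≈⟨ kQ≈x ⟩
    x               ∎)

  ∈2^-antitone : ∀ {n k x} → n ≤ k → x ∈2^ k A → x ∈2^ n A
  ∈2^-antitone n≤k = ∈·A-∣ (^-monoʳ-∣ 2 n≤k)

  ·-root-transfer : ∀ {n k Q P P′} → n · Q ≈ P → (P - P′) ∈ (n * k) ·A →
                    ∃[ Q′ ] (n · Q′ ≈ P′ × (Q - Q′) ∈ k ·A)
  ·-root-transfer {n} {k} {Q} {P} {P′} nQ≈P (R , nkR≈P-P′) =
    Q - k · R , (begin
      n · (Q - k · R)         ≈⟨ ·-distrib-- n Q (k · R) ⟩
      n · Q - n · (k · R)     ≈⟨ //-cong₂ nQ≈P (trans (·-assocˡ n k R) nkR≈P-P′) ⟩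
      P - (P - P′)            ≈⟨ x-[x-y]≈y P P′ ⟩
      P′                      ∎)
    , (R , sym (x-[x-y]≈y Q (k · R)))

  module _ {k : ℕ} {P P′ : Carrier} (P∉ : ¬ (P ∈2^ k A)) (P-P′∈ : (P - P′) ∈2^ k A) where

    ∈2^-transfer : ∀ n → P ∈2^ n A → P′ ∈2^ n A
    ∈2^-transfer n P∈ with n ≤? k
    ... | yes n≤k = ∈·A-transfer {2 ^ n} (∈2^-antitone n≤k P-P′∈) P∈
    ... | no  n≰k = ⊥-elim (P∉ (∈2^-antitone (<⇒≤ (≰⇒> n≰k)) P∈))

    ∈q-transfer : ∀ x → x ∈q P → x ∈q P′
    ∈q-transfer x (Q , n , 2ⁿQ≈P , x≡Q) with n <? k
    ... | no  n≮k = ⊥-elim (P∉ (∈2^-antitone (≮⇒≥ n≮k) (Q , 2ⁿQ≈P)))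
    ... | yes n<k with ·-root-transfer {2 ^ n} {2} 2ⁿQ≈P (∈·A-∣ 2ⁿ⁺¹∣2ᵏ P-P′∈)
      where
      2ⁿ⁺¹∣2ᵏ : 2 ^ n * 2 ∣ 2 ^ k
      2ⁿ⁺¹∣2ᵏ = ≡.subst (_∣ 2 ^ k) (*-comm 2 (2 ^ n)) (^-monoʳ-∣ 2 n<k)
    ...   | Q′ , 2ⁿQ′≈P′ , Q≡Q′ = Q′ , n , 2ⁿQ′≈P′ , ∈·A-trans {2} x≡Q Q≡Q′

  divisibility-and-roots-⇔ : ∀ k {P P′} → ¬ (P ∈2^ k A) → (P - P′) ∈2^ k A →
                             (∀ n → P ∈2^ n A ⇔ P′ ∈2^ n A) × (∀ x → x ∈q P ⇔ x ∈q P′)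
  divisibility-and-roots-⇔ k {P} {P′} P∉ P-P′∈ =
      (λ n → mk⇔ (∈2^-transfer {k} P∉ P-P′∈ n) (∈2^-transfer {k} P′∉ P′-P∈ n))
    , (λ x → mk⇔ (∈q-transfer {k} P∉ P-P′∈ x) (∈q-transfer {k} P′∉ P′-P∈ x))
    where
    P′-P∈ : (P′ - P) ∈2^ k A
    P′-P∈ = ∈·A-sym {2 ^ k} P-P′∈
    P′∉ : ¬ (P′ ∈2^ k A)
    P′∉ = λ P′∈ → P∉ (∈·A-transfer {2 ^ k} P′-P∈ P′∈)

lemma4p1 : ∀ {c ℓ} (J : AbelianGroup c ℓ) (m : ℕ) (P₁ P₂ : AbelianGroup.Carrier J) →
    let open AbelianGroup J
        open AbGroupNotions J
    in ¬ (P₁ ∈2^ suc m A) → (P₁ - P₂) ∈2^ suc m A →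
       (∀ v → ν≡ P₁ v ⇔ ν≡ P₂ v) × (∀ x → x ∈q P₁ ⇔ x ∈q P₂)
lemma4p1 J m P₁ P₂ P₁∉ P₁-P₂∈ =
  let divisibility⇔ , roots⇔ = Divisibility.divisibility-and-roots-⇔ J (suc m) P₁∉ P₁-P₂∈
  in IsSup-⇔ divisibility⇔ , roots⇔
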